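{- Let $\mathfrak G=\langle V,E\rangle$ be an undirected graph and $\delta$ a $k$-sparse distribution of $\mathfrak G$. Then $\mathfrak G$ has a $\delta$-flow $f$ that is edge-bounded by $k$.
   Context: A distribution is a map $\delta:V\to\omega$, with $\delta(X)=\sum_{v\in X}\delta(v)$. The border of $Z\subseteq V$ is $B_{\mathfrak G}(Z)=E\cap((V\setminus Z)\times Z)$. $\delta$ is $k$-sparse if $\delta(Z)\le|Z|+k|B_{\mathfrak G}(Z)|$ for all $Z\subseteq V$. A flow is a function $f:V\times V\to\mathbb Z$ with $f(u,v)=-f(v,u)$ and $f(u,v)\ne0\Rightarrow(u,v)\in E$. Its defect is $d_f(v)=\sum_{u\in V}f(v,u)$. $f$ is a $\delta$-flow if for every $v$ either $d_f(v)=\delta(v)-1$, or $\delta(v)=0$ and $d_f(v)=0$. $f$ is edge-bounded by $k$ if $|f(u,v)|\le k$ for all $u,v$. -}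

module Defs where

open import Data.Nat using (ℕ; zero; suc; _+_; _*_; _≤_)
open import Data.Integer as ℤ using (ℤ; +_; -_) renaming (∣_∣ to abs; _+_ to _+ℤ_; _-_ to _-ℤ_)
open import Data.Fin using (Fin; zero; suc)
open import Data.Fin.Subset using (Subset; ∣_∣)
open import Data.Vec using (lookup)
open import Data.Bool using (Bool; true; false; if_then_else_; _∧_; not)
open import Data.Product using (_×_; Σ)
open import Data.Sum using (_⊎_)
open import Relation.Binary.PropositionalEquality using (_≡_; _≢_)

sumℕ : {n : ℕ} → (Fin n → ℕ) → ℕ
sumℕ {zero} f = 0
sumℕ {suc n} f = f zero + sumℕ (λ i → f (suc i))

sumℤ : {n : ℕ} → (Fin n → ℤ) → ℤ
sumℤ {zero} f = + 0
sumℤ {suc n} f = f zero +ℤ sumℤ (λ i → f (suc i))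

record Graph (n : ℕ) : Set where
  field
    adj : Fin n → Fin n → Bool
    adj-sym : ∀ u v → adj u v ≡ adj v u
open Graph public

Distribution : ℕ → Set
Distribution n = Fin n → ℕ

δsum : {n : ℕ} → Distribution n → Subset n → ℕ
δsum δ X = sumℕ (λ v → if lookup X v then δ v else 0)

-- |B(Z)| = |E ∩ ((V∖Z) × Z)|  (ordered pairs (u,v))
borderSize : {n : ℕ} → Graph n → Subset n → ℕ
borderSize G Z = sumℕ (λ u → sumℕ (λ v →
  if adj G u v ∧ not (lookup Z u) ∧ lookup Z v then 1 else 0))

Sparse : {n : ℕ} → ℕ → Graph n → Distribution n → Set
Sparse k G δ = ∀ (Z : Subset _) → δsum δ Z ≤ ∣ Z ∣ + k * borderSize G Z

Flow : {n : ℕ} → Graph n → (Fin n → Fin n → ℤ) → Set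
Flow G f = (∀ u v → f u v ≡ - f v u) × (∀ u v → f u v ≢ + 0 → adj G u v ≡ true)

defect : {n : ℕ} → (Fin n → Fin n → ℤ) → Fin n → ℤ
defect f v = sumℤ (λ u → f v u)

IsδFlow : {n : ℕ} → Graph n → Distribution n → (Fin n → Fin n → ℤ) → Set
IsδFlow G δ f = Flow G f ×
  (∀ v → (defect f v ≡ + δ v -ℤ + 1) ⊎ ((δ v ≡ 0) × (defect f v ≡ + 0)))

EdgeBounded : {n : ℕ} → ℕ → (Fin n → Fin n → ℤ) → Set
EdgeBounded k f = ∀ u v → abs (f u v) ≤ k

module Submission where

-- Work with arbitrary directed capacities c instead of k times the adjacency relation, sparsity
-- reading δ(Z) ≤ |Z| + c(arcs leaving Z). Call v a hole if δ v = 0 and a surplus vertex if δ v ≥ 2.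
-- Without surplus vertices the zero flow is a δ-flow. Otherwise some surplus vertex s reaches a
-- hole along arcs of positive capacity: if not, the set Z of vertices reaching no hole has no
-- capacity leaving it while δ(Z) ≥ |Z| + 1. Take s reaching a hole in j + 1 steps but not in j,
-- and its neighbour x reaching one in j steps. Moving one unit of δ from s to x, and one unit of
-- capacity from the arc s → x to x → s, preserves sparsity, and adding one unit of flow along
-- s → x to a flow for the new data gives a flow for the old. The move either fills the hole x or
-- makes x a surplus vertex reaching a hole in j steps, so iterating terminates. Since f u v ≤ c u v
-- and f is antisymmetric, the flow obtained is edge-bounded by k.

open import Defs
open import Algebra.Properties.CommutativeSemigroup as CommSemigroupProps using ()
open import Data.Bool using (Bool; true; false; if_then_else_; not; _∧_)
open import Data.Bool.Properties using (∧-zeroʳ)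
open import Data.Fin using (Fin; zero; suc; _≟_)
open import Data.Fin.Properties using (any?; suc-injective)
open import Data.Fin.Subset using (Subset; ∣_∣; _∈_; _∉_; _⊆_; _⊂_)
open import Data.Fin.Subset.Properties using (p⊂q⇒∣p∣<∣q∣; p⊆q⇒∣p∣≤∣q∣; ∣p∣≤n)
open import Data.Integer as ℤ using (ℤ; +_; -_) renaming (_+_ to _+ℤ_; _-_ to _-ℤ_; _≤_ to _≤ℤ_)
import Data.Integer.Properties as ℤ
open import Data.Integer.Tactic.RingSolver using (solve-∀)
open import Data.Nat as ℕ using (ℕ; zero; suc; _+_; _*_; _∸_; _≤_; _<_; z≤n; s≤s)
open import Data.Nat.Properties hiding (_≟_; suc-injective)
open import Data.Product using (Σ; _×_; _,_; ∃-syntax; map₂)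
open import Data.Sum using (_⊎_; inj₁; inj₂)
open import Data.Vec using (lookup; tabulate; []; _∷_)
open import Data.Vec.Properties using (lookup∘tabulate; lookup⇒[]=; []=⇒lookup)
open import Function using (_∘_)
open import Relation.Binary.PropositionalEquality
open import Relation.Nullary using (does; yes; no; ¬_; contradiction)
open import Relation.Nullary.Decidable using (dec-true; dec-false; _⊎-dec_; _×-dec_; ¬?; decidable-stable)
open import Relation.Unary using (Decidable)

open CommSemigroupProps +-commutativeSemigroup using () renaming (interchange to +-interchange)
open CommSemigroupProps ℤ.+-commutativeSemigroup using () renaming (interchange to +ℤ-interchange)

private variable n : ℕ

-- Finite sums

sumℕ-cong : {f g : Fin n → ℕ} → (∀ v → f v ≡ g v) → sumℕ f ≡ sumℕ g
sumℕ-cong {zero}  eq = refl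
sumℕ-cong {suc n} eq = cong₂ _+_ (eq zero) (sumℕ-cong (eq ∘ suc))

sumℕ-mono : {f g : Fin n → ℕ} → (∀ v → f v ≤ g v) → sumℕ f ≤ sumℕ g
sumℕ-mono {zero}  le = z≤n
sumℕ-mono {suc n} le = +-mono-≤ (le zero) (sumℕ-mono (le ∘ suc))

sumℕ-+ : (f g : Fin n → ℕ) → sumℕ (λ v → f v + g v) ≡ sumℕ f + sumℕ g
sumℕ-+ {zero}  f g = refl
sumℕ-+ {suc n} f g = trans (cong (_+_ (f zero + g zero)) (sumℕ-+ (f ∘ suc) (g ∘ suc)))
                           (+-interchange (f zero) (g zero) _ _)

sumℕ-*ˡ : (k : ℕ) (f : Fin n → ℕ) → sumℕ (λ v → k * f v) ≡ k * sumℕ f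
sumℕ-*ˡ {zero}  k f = sym (*-zeroʳ k)
sumℕ-*ˡ {suc n} k f = trans (cong (_+_ (k * f zero)) (sumℕ-*ˡ k (f ∘ suc)))
                            (sym (*-distribˡ-+ k (f zero) _))

sumℕ-zero : (f : Fin n → ℕ) → (∀ v → f v ≡ 0) → sumℕ f ≡ 0
sumℕ-zero {zero}  f eq = refl
sumℕ-zero {suc n} f eq = cong₂ _+_ (eq zero) (sumℕ-zero (f ∘ suc) (eq ∘ suc))

sumℕ-point : (f : Fin n → ℕ) (a : Fin n) → (∀ v → v ≢ a → f v ≡ 0) → sumℕ f ≡ f a
sumℕ-point {suc n} f zero    eq = trans (cong (_+_ (f zero)) (sumℕ-zero (f ∘ suc) λ v → eq (suc v) λ ()))
                                        (+-identityʳ (f zero))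
sumℕ-point {suc n} f (suc a) eq =
  cong₂ _+_ (eq zero λ ()) (sumℕ-point (f ∘ suc) a λ v v≢a → eq (suc v) (v≢a ∘ suc-injective))

sumℤ-+ : (f g : Fin n → ℤ) → sumℤ (λ v → f v +ℤ g v) ≡ sumℤ f +ℤ sumℤ g
sumℤ-+ {zero}  f g = refl
sumℤ-+ {suc n} f g = trans (cong (_+ℤ_ (f zero +ℤ g zero)) (sumℤ-+ (f ∘ suc) (g ∘ suc)))
                           (+ℤ-interchange (f zero) (g zero) _ _)

sumℤ-neg : (f : Fin n → ℤ) → sumℤ (λ v → - f v) ≡ - sumℤ f
sumℤ-neg {zero}  f = refl
sumℤ-neg {suc n} f = trans (cong (_+ℤ_ (- f zero)) (sumℤ-neg (f ∘ suc))) (sym (ℤ.neg-distrib-+ (f zero) _))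

sumℤ-pos : (f : Fin n → ℕ) → sumℤ (λ v → + f v) ≡ + sumℕ f
sumℤ-pos {zero}  f = refl
sumℤ-pos {suc n} f = cong (_+ℤ_ (+ f zero)) (sumℤ-pos (f ∘ suc))

sumℤ-zero : sumℤ {n} (λ _ → + 0) ≡ + 0
sumℤ-zero {zero}  = refl
sumℤ-zero {suc n} = trans (ℤ.+-identityˡ _) (sumℤ-zero {n})

iverson : Bool → ℕ
iverson b = if b then 1 else 0

restrict : (Fin n → Bool) → (Fin n → ℕ) → Fin n → ℕ
restrict P f v = if P v then f v else 0

sumOver : (Fin n → Bool) → (Fin n → ℕ) → ℕ
sumOver P f = sumℕ (restrict P f)

if-+ : ∀ b x y → (if b then x + y else 0) ≡ (if b then x else 0) + (if b then y else 0)
if-+ true  x y = refl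
if-+ false x y = refl

if-*ˡ : ∀ b k x → (if b then k * x else 0) ≡ k * (if b then x else 0)
if-*ˡ true  k x = refl
if-*ˡ false k x = sym (*-zeroʳ k)

if-mono : ∀ b {x y} → (b ≡ true → x ≤ y) → (if b then x else 0) ≤ (if b then y else 0)
if-mono true  le = le refl
if-mono false le = z≤n

if-zero : ∀ b {x} → (b ≡ true → x ≡ 0) → (if b then x else 0) ≡ 0
if-zero true  eq = eq refl
if-zero false eq = refl

module _ (P : Fin n → Bool) where

  sumOver-cong : {f g : Fin n → ℕ} → (∀ v → f v ≡ g v) → sumOver P f ≡ sumOver P g
  sumOver-cong eq = sumℕ-cong λ v → cong (λ t → if P v then t else 0) (eq v)

  sumOver-mono : {f g : Fin n → ℕ} → (∀ v → P v ≡ true → f v ≤ g v) → sumOver P f ≤ sumOver P g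
  sumOver-mono le = sumℕ-mono λ v → if-mono (P v) (le v)

  sumOver-zero : {f : Fin n → ℕ} → (∀ v → P v ≡ true → f v ≡ 0) → sumOver P f ≡ 0
  sumOver-zero {f} eq = sumℕ-zero (restrict P f) λ v → if-zero (P v) (eq v)

  sumOver-+ : (f g : Fin n → ℕ) → sumOver P (λ v → f v + g v) ≡ sumOver P f + sumOver P g
  sumOver-+ f g = trans (sumℕ-cong λ v → if-+ (P v) (f v) (g v)) (sumℕ-+ (restrict P f) (restrict P g))

  sumOver-*ˡ : (k : ℕ) (f : Fin n → ℕ) → sumOver P (λ v → k * f v) ≡ k * sumOver P f
  sumOver-*ˡ k f = trans (sumℕ-cong λ v → if-*ˡ (P v) k (f v)) (sumℕ-*ˡ k (restrict P f))

  sumOver-*ʳ : (f : Fin n → ℕ) (k : ℕ) → sumOver P (λ v → f v * k) ≡ sumOver P f * k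
  sumOver-*ʳ f k = begin
    sumOver P (λ v → f v * k)   ≡⟨ sumOver-cong (λ v → *-comm (f v) k) ⟩
    sumOver P (λ v → k * f v)   ≡⟨ sumOver-*ˡ k f ⟩
    k * sumOver P f             ≡⟨ *-comm k _ ⟩
    sumOver P f * k             ∎
    where open ≡-Reasoning

  sumOver-balance : {f f′ a b : Fin n → ℕ} → (∀ v → f′ v + a v ≡ f v + b v) →
                    sumOver P f′ + sumOver P a ≡ sumOver P f + sumOver P b
  sumOver-balance {f} {f′} {a} {b} eq = begin
    sumOver P f′ + sumOver P a         ≡⟨ sumOver-+ f′ a ⟨
    sumOver P (λ v → f′ v + a v)       ≡⟨ sumOver-cong eq ⟩
    sumOver P (λ v → f v + b v)        ≡⟨ sumOver-+ f b ⟩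
    sumOver P f + sumOver P b          ∎
    where open ≡-Reasoning

iverson-∧ : ∀ x y → iverson x * iverson y ≡ iverson (x ∧ y)
iverson-∧ true  y = +-identityʳ (iverson y)
iverson-∧ false y = refl

𝟙 : Fin n → Fin n → ℕ
𝟙 a v = iverson (does (v ≟ a))

𝟙-self : (a : Fin n) → 𝟙 a a ≡ 1
𝟙-self a = cong iverson (dec-true (a ≟ a) refl)

𝟙-other : {a v : Fin n} → v ≢ a → 𝟙 a v ≡ 0
𝟙-other {a = a} {v} v≢a = cong iverson (dec-false (v ≟ a) v≢a)

𝟙-≤ : {f : Fin n → ℕ} {a : Fin n} → 1 ≤ f a → ∀ v → 𝟙 a v ≤ f v
𝟙-≤ {a = a} 1≤fa v with v ≟ a
... | yes refl = 1≤fa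
... | no  _    = z≤n

sumOver-𝟙 : (P : Fin n → Bool) (a : Fin n) → sumOver P (𝟙 a) ≡ iverson (P a)
sumOver-𝟙 P a = trans (sumℕ-point (restrict P (𝟙 a)) a λ v v≢a → if-zero (P v) λ _ → 𝟙-other v≢a)
                      (cong (λ t → if P a then t else 0) (𝟙-self a))

-- Capacities and unit transfers

Capacity : ℕ → Set
Capacity n = Fin n → Fin n → ℕ

arc : Fin n → Fin n → Capacity n
arc a b u v = 𝟙 a u * 𝟙 b v

arc-transpose : (a b u v : Fin n) → arc a b u v ≡ arc b a v u
arc-transpose a b u v = *-comm (𝟙 a u) (𝟙 b v)

arc-≤ : {c : Capacity n} {a b : Fin n} → 1 ≤ c a b → ∀ u v → arc a b u v ≤ c u v
arc-≤ {a = a} {b} 1≤cab u v with u ≟ a | v ≟ b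
... | yes refl | yes refl = 1≤cab
... | yes refl | no  _    = z≤n
... | no  _    | _        = z≤n

sumℕ-arc : (a b u : Fin n) → sumℕ (arc a b u) ≡ 𝟙 a u
sumℕ-arc a b u = begin
  sumℕ (λ v → 𝟙 a u * 𝟙 b v)   ≡⟨ sumℕ-*ˡ (𝟙 a u) (𝟙 b) ⟩
  𝟙 a u * sumℕ (𝟙 b)           ≡⟨ cong (_*_ (𝟙 a u)) (sumOver-𝟙 (λ _ → true) b) ⟩
  𝟙 a u * 1                    ≡⟨ *-identityʳ (𝟙 a u) ⟩
  𝟙 a u                        ∎
  where open ≡-Reasoning

outCapacity : Capacity n → Subset n → ℕ
outCapacity c Z = sumOver (not ∘ lookup Z) (λ u → sumOver (lookup Z) (λ v → c v u))

outCapacity-arc : (a b : Fin n) (Z : Subset n) →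
                  outCapacity (arc a b) Z ≡ iverson (lookup Z a ∧ not (lookup Z b))
outCapacity-arc a b Z = begin
  sumOver (not ∘ lookup Z) (λ u → sumOver (lookup Z) (λ v → 𝟙 a v * 𝟙 b u))
    ≡⟨ sumOver-cong (not ∘ lookup Z) (λ u → sumOver-*ʳ (lookup Z) (𝟙 a) (𝟙 b u)) ⟩
  sumOver (not ∘ lookup Z) (λ u → sumOver (lookup Z) (𝟙 a) * 𝟙 b u)
    ≡⟨ sumOver-cong (not ∘ lookup Z) (λ u → cong (_* 𝟙 b u) (sumOver-𝟙 (lookup Z) a)) ⟩
  sumOver (not ∘ lookup Z) (λ u → iverson (lookup Z a) * 𝟙 b u)
    ≡⟨ sumOver-*ˡ (not ∘ lookup Z) (iverson (lookup Z a)) (𝟙 b) ⟩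
  iverson (lookup Z a) * sumOver (not ∘ lookup Z) (𝟙 b)
    ≡⟨ cong (_*_ (iverson (lookup Z a))) (sumOver-𝟙 (not ∘ lookup Z) b) ⟩
  iverson (lookup Z a) * iverson (not (lookup Z b))
    ≡⟨ iverson-∧ (lookup Z a) (not (lookup Z b)) ⟩
  iverson (lookup Z a ∧ not (lookup Z b))
    ∎
  where open ≡-Reasoning

Fits : ℕ → ℤ → Set
Fits d D = (D ≡ + d -ℤ + 1) ⊎ (d ≡ 0 × D ≡ + 0)

IsCapFlow : Distribution n → Capacity n → (Fin n → Fin n → ℤ) → Set
IsCapFlow δ c f = (∀ u v → f u v ≡ - f v u) × (∀ u v → f u v ≤ℤ + c u v) × (∀ v → Fits (δ v) (defect f v))

CapFlow : Distribution n → Capacity n → Set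
CapFlow {n} δ c = Σ (Fin n → Fin n → ℤ) (IsCapFlow δ c)

CapSparse : Distribution n → Capacity n → Set
CapSparse δ c = ∀ Z → δsum δ Z ≤ ∣ Z ∣ + outCapacity c Z

Fits-shift : ∀ {d d′ a b D D′} → d′ + a ≡ d + b → (d′ ≡ 0 → a ≡ 0) →
             D ≡ D′ +ℤ (+ a -ℤ + b) → Fits d′ D′ → Fits d D
Fits-shift {d} {d′} {a} {b} {D} {D′} balance _ D≡ (inj₁ D′≡) = inj₁ (begin
  D                                ≡⟨ D≡ ⟩
  D′ +ℤ (+ a -ℤ + b)               ≡⟨ cong (λ t → t +ℤ (+ a -ℤ + b)) D′≡ ⟩
  + d′ -ℤ + 1 +ℤ (+ a -ℤ + b)      ≡⟨ regroup (+ d′) (+ a) (+ b) ⟩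
  + d′ +ℤ + a -ℤ + b -ℤ + 1        ≡⟨ cong (λ t → + t -ℤ + b -ℤ + 1) balance ⟩
  + d +ℤ + b -ℤ + b -ℤ + 1         ≡⟨ cancel (+ d) (+ b) ⟩
  + d -ℤ + 1                       ∎)
  where
  open ≡-Reasoning
  regroup : ∀ p q r → p -ℤ + 1 +ℤ (q -ℤ r) ≡ p +ℤ q -ℤ r -ℤ + 1
  regroup = solve-∀
  cancel : ∀ p q → p +ℤ q -ℤ q -ℤ + 1 ≡ p -ℤ + 1
  cancel = solve-∀
Fits-shift {d} {b = b} balance a≡0 D≡ (inj₂ (refl , refl)) rewrite a≡0 refl =
  inj₂ (d≡0 , trans D≡ (cong (λ t → + 0 +ℤ (+ 0 -ℤ + t)) b≡0))
  where
  d≡0 : d ≡ 0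
  d≡0 = m+n≡0⇒m≡0 d (sym balance)
  b≡0 : b ≡ 0
  b≡0 = m+n≡0⇒n≡0 d (sym balance)

bound-shift : ∀ {F c c′ a b} → F ≤ℤ + c′ → c′ + a ≡ c + b → F +ℤ (+ a -ℤ + b) ≤ℤ + c
bound-shift {F} {c} {c′} {a} {b} F≤c′ balance = begin
  F +ℤ (+ a -ℤ + b)       ≤⟨ ℤ.+-monoˡ-≤ (+ a -ℤ + b) F≤c′ ⟩
  + c′ +ℤ (+ a -ℤ + b)    ≡⟨ ℤ.+-assoc (+ c′) (+ a) (- + b) ⟨
  + (c′ + a) -ℤ + b       ≡⟨ cong (λ t → + t -ℤ + b) balance ⟩
  + c +ℤ + b -ℤ + b       ≡⟨ cancel (+ c) (+ b) ⟩
  + c                     ∎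
  where
  open ℤ.≤-Reasoning
  cancel : ∀ p q → p +ℤ q -ℤ q ≡ p
  cancel = solve-∀

transfer-≤ : ∀ σ ξ {z d d′ w w′} →
             d′ + iverson σ ≡ d + iverson ξ → w′ + iverson (σ ∧ not ξ) ≡ w + iverson (ξ ∧ not σ) →
             d ≤ z + w → d′ ≤ z + w′
transfer-≤ true  true  {z} {d} {d′} {w} {w′} δ-eq w-eq d≤ =
  subst₂ (λ p q → p ≤ z + q) (+-cancelʳ-≡ 1 d d′ (sym δ-eq)) (+-cancelʳ-≡ 0 w w′ (sym w-eq)) d≤
transfer-≤ false false {z} {d} {d′} {w} {w′} δ-eq w-eq d≤ =
  subst₂ (λ p q → p ≤ z + q) (+-cancelʳ-≡ 0 d d′ (sym δ-eq)) (+-cancelʳ-≡ 0 w w′ (sym w-eq)) d≤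
transfer-≤ true  false {z} {d} {d′} {w} {w′} δ-eq w-eq d≤ = +-cancelʳ-≤ 1 d′ (z + w′) (begin
  d′ + 1          ≡⟨ δ-eq ⟩
  d + 0           ≡⟨ +-identityʳ d ⟩
  d               ≤⟨ d≤ ⟩
  z + w           ≡⟨ cong (_+_ z) (trans w-eq (+-identityʳ w)) ⟨
  z + (w′ + 1)    ≡⟨ +-assoc z w′ 1 ⟨
  z + w′ + 1      ∎)
  where open ≤-Reasoning
transfer-≤ false true {z} {d} {d′} {w} {w′} δ-eq w-eq d≤ = begin
  d′              ≡⟨ +-identityʳ d′ ⟨
  d′ + 0          ≡⟨ δ-eq ⟩
  d + 1           ≤⟨ +-monoˡ-≤ 1 d≤ ⟩
  z + w + 1       ≡⟨ +-assoc z w 1 ⟩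
  z + (w + 1)     ≡⟨ cong (_+_ z) (trans (sym w-eq) (+-identityʳ w′)) ⟩
  z + w′          ∎
  where open ≤-Reasoning

arcFlow : Fin n → Fin n → Fin n → Fin n → ℤ
arcFlow a b u v = + arc a b u v -ℤ + arc b a u v

defect-arcFlow : (a b v : Fin n) → defect (arcFlow a b) v ≡ + 𝟙 a v -ℤ + 𝟙 b v
defect-arcFlow a b v = begin
  sumℤ (λ u → + arc a b v u +ℤ - + arc b a v u)
    ≡⟨ sumℤ-+ (λ u → + arc a b v u) (λ u → - + arc b a v u) ⟩
  sumℤ (λ u → + arc a b v u) +ℤ sumℤ (λ u → - + arc b a v u)
    ≡⟨ cong (_+ℤ_ (sumℤ (λ u → + arc a b v u))) (sumℤ-neg (λ u → + arc b a v u)) ⟩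
  sumℤ (λ u → + arc a b v u) -ℤ sumℤ (λ u → + arc b a v u)
    ≡⟨ cong₂ _-ℤ_ (sumℤ-pos (arc a b v)) (sumℤ-pos (arc b a v)) ⟩
  + sumℕ (arc a b v) -ℤ + sumℕ (arc b a v)
    ≡⟨ cong₂ (λ p q → + p -ℤ + q) (sumℕ-arc a b v) (sumℕ-arc b a v) ⟩
  + 𝟙 a v -ℤ + 𝟙 b v
    ∎
  where open ≡-Reasoning

module Transfer {δ δ′ : Distribution n} {c c′ : Capacity n} {s x : Fin n}
  (δ-balance : ∀ v → δ′ v + 𝟙 s v ≡ δ v + 𝟙 x v)
  (c-balance : ∀ u v → c′ u v + arc s x u v ≡ c u v + arc x s u v)
  (1≤δ′s : 1 ≤ δ′ s) where

  source-free : ∀ {v} → δ′ v ≡ 0 → 𝟙 s v ≡ 0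
  source-free {v} δ′v≡0 with v ≟ s
  ... | yes refl = contradiction (subst (1 ≤_) δ′v≡0 1≤δ′s) λ ()
  ... | no  _    = refl

  sparse-preserved : CapSparse δ c → CapSparse δ′ c′
  sparse-preserved sp Z = transfer-≤ (lookup Z s) (lookup Z x) δ-eq c-eq (sp Z)
    where
    open ≡-Reasoning
    δ-eq : δsum δ′ Z + iverson (lookup Z s) ≡ δsum δ Z + iverson (lookup Z x)
    δ-eq = begin
      δsum δ′ Z + iverson (lookup Z s)                    ≡⟨ cong (_+_ (δsum δ′ Z)) (sumOver-𝟙 (lookup Z) s) ⟨
      δsum δ′ Z + sumOver (lookup Z) (𝟙 s)                ≡⟨ sumOver-balance (lookup Z) δ-balance ⟩
      δsum δ Z + sumOver (lookup Z) (𝟙 x)                 ≡⟨ cong (_+_ (δsum δ Z)) (sumOver-𝟙 (lookup Z) x) ⟩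
      δsum δ Z + iverson (lookup Z x)                     ∎
    c-eq : outCapacity c′ Z + iverson (lookup Z s ∧ not (lookup Z x))
         ≡ outCapacity c Z + iverson (lookup Z x ∧ not (lookup Z s))
    c-eq = begin
      outCapacity c′ Z + iverson (lookup Z s ∧ not (lookup Z x)) ≡⟨ cong (_+_ (outCapacity c′ Z)) (outCapacity-arc s x Z) ⟨
      outCapacity c′ Z + outCapacity (arc s x) Z                ≡⟨ sumOver-balance (not ∘ lookup Z)
                                                                      (λ u → sumOver-balance (lookup Z) (λ v → c-balance v u)) ⟩
      outCapacity c Z + outCapacity (arc x s) Z                 ≡⟨ cong (_+_ (outCapacity c Z)) (outCapacity-arc x s Z) ⟩
      outCapacity c Z + iverson (lookup Z x ∧ not (lookup Z s)) ∎

  lift : CapFlow δ′ c′ → CapFlow δ c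
  lift (f′ , antisym , bounded , fits) = f , antisym′ , bounded′ , fits′
    where
    f : Fin n → Fin n → ℤ
    f u v = f′ u v +ℤ arcFlow s x u v
    antisym′ : ∀ u v → f u v ≡ - f v u
    antisym′ u v = begin
      f′ u v +ℤ (+ arc s x u v -ℤ + arc x s u v)     ≡⟨ cong (_+ℤ arcFlow s x u v) (antisym u v) ⟩
      - f′ v u +ℤ (+ arc s x u v -ℤ + arc x s u v)   ≡⟨ cong₂ (λ q r → - f′ v u +ℤ (+ q -ℤ + r))
                                                          (arc-transpose s x u v) (arc-transpose x s u v) ⟩
      - f′ v u +ℤ (+ arc x s v u -ℤ + arc s x v u)   ≡⟨ neg-swap (f′ v u) (+ arc x s v u) (+ arc s x v u) ⟩
      - f v u                                        ∎
      where
      open ≡-Reasoning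
      neg-swap : ∀ p q r → - p +ℤ (q -ℤ r) ≡ - (p +ℤ (r -ℤ q))
      neg-swap = solve-∀
    bounded′ : ∀ u v → f u v ≤ℤ + c u v
    bounded′ u v = bound-shift (bounded u v) (c-balance u v)
    fits′ : ∀ v → Fits (δ v) (defect f v)
    fits′ v = Fits-shift (δ-balance v) source-free
      (trans (sumℤ-+ (f′ v) (arcFlow s x v)) (cong (_+ℤ_ (defect f′ v)) (defect-arcFlow s x v))) (fits v)

  hole-back : ∀ {v} → δ′ v ≡ 0 → δ v ≡ 0
  hole-back {v} δ′v≡0 = m+n≡0⇒m≡0 (δ v) (trans (sym (δ-balance v)) (cong₂ _+_ δ′v≡0 (source-free δ′v≡0)))

  hole-forth : 1 ≤ δ x → ∀ {v} → δ v ≡ 0 → δ′ v ≡ 0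
  hole-forth 1≤δx {v} δv≡0 = m+n≡0⇒m≡0 (δ′ v) (trans (δ-balance v) (cong₂ _+_ δv≡0 (𝟙-other v≢x)))
    where
    v≢x : v ≢ x
    v≢x refl = contradiction (subst (1 ≤_) δv≡0 1≤δx) λ ()

  target-gains : s ≢ x → δ′ x ≡ δ x + 1
  target-gains s≢x = begin
    δ′ x            ≡⟨ +-identityʳ (δ′ x) ⟨
    δ′ x + 0        ≡⟨ cong (_+_ (δ′ x)) (𝟙-other (s≢x ∘ sym)) ⟨
    δ′ x + 𝟙 s x    ≡⟨ δ-balance x ⟩
    δ x + 𝟙 x x     ≡⟨ cong (_+_ (δ x)) (𝟙-self x) ⟩
    δ x + 1         ∎
    where open ≡-Reasoning

  capacity-grows : ∀ {u} v → u ≢ s → c u v ≤ c′ u v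
  capacity-grows {u} v u≢s = begin
    c u v                      ≤⟨ m≤m+n (c u v) (arc x s u v) ⟩
    c u v + arc x s u v        ≡⟨ c-balance u v ⟨
    c′ u v + arc s x u v       ≡⟨ cong (λ t → c′ u v + t * 𝟙 x v) (𝟙-other u≢s) ⟩
    c′ u v + 0                 ≡⟨ +-identityʳ (c′ u v) ⟩
    c′ u v                     ∎
    where open ≤-Reasoning

pushDist : Distribution n → Fin n → Fin n → Distribution n
pushDist δ s x v = δ v ∸ 𝟙 s v + 𝟙 x v

pushCap : Capacity n → Fin n → Fin n → Capacity n
pushCap c s x u v = c u v ∸ arc s x u v + arc x s u v

m∸n+o+n≡m+o : ∀ {m n} o → n ≤ m → m ∸ n + o + n ≡ m + o
m∸n+o+n≡m+o {m} {n} o n≤m = begin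
  m ∸ n + o + n     ≡⟨ +-assoc (m ∸ n) o n ⟩
  m ∸ n + (o + n)   ≡⟨ cong (_+_ (m ∸ n)) (+-comm o n) ⟩
  m ∸ n + (n + o)   ≡⟨ +-assoc (m ∸ n) n o ⟨
  m ∸ n + n + o     ≡⟨ cong (_+ o) (m∸n+n≡m n≤m) ⟩
  m + o             ∎
  where open ≡-Reasoning

pushDist-balance : {δ : Distribution n} {s : Fin n} (x : Fin n) → 1 ≤ δ s →
                   ∀ v → pushDist δ s x v + 𝟙 s v ≡ δ v + 𝟙 x v
pushDist-balance x 1≤δs v = m∸n+o+n≡m+o (𝟙 x v) (𝟙-≤ 1≤δs v)

pushCap-balance : {c : Capacity n} {s x : Fin n} → 1 ≤ c s x →
                  ∀ u v → pushCap c s x u v + arc s x u v ≡ c u v + arc x s u v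
pushCap-balance {s = s} {x} 1≤csx u v = m∸n+o+n≡m+o (arc x s u v) (arc-≤ 1≤csx u v)

pushDist-source : {δ : Distribution n} {s : Fin n} (x : Fin n) → 2 ≤ δ s → 1 ≤ pushDist δ s x s
pushDist-source {δ = δ} {s} x 2≤δs = +-cancelʳ-≤ 1 1 (pushDist δ s x s) (begin
  2                           ≤⟨ 2≤δs ⟩
  δ s                         ≤⟨ m≤m+n (δ s) (𝟙 x s) ⟩
  δ s + 𝟙 x s                 ≡⟨ pushDist-balance {δ = δ} x (≤-trans (s≤s z≤n) 2≤δs) s ⟨
  pushDist δ s x s + 𝟙 s s    ≡⟨ cong (_+_ (pushDist δ s x s)) (𝟙-self s) ⟩
  pushDist δ s x s + 1        ∎)
  where open ≤-Reasoning

-- Reaching holes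

module _ {P : Fin n → Set} (P? : Decidable P) where

  select : Subset n
  select = tabulate (does ∘ P?)

  lookup-select⁺ : ∀ {v} → P v → lookup select v ≡ true
  lookup-select⁺ {v} p = trans (lookup∘tabulate (does ∘ P?) v) (dec-true (P? v) p)

  lookup-select⁻ : ∀ {v} → lookup select v ≡ true → P v
  lookup-select⁻ {v} eq with P? v | trans (sym (lookup∘tabulate (does ∘ P?) v)) eq
  ... | yes p | _  = p
  ... | no  _ | ()

  lookup-select-false : ∀ {v} → lookup select v ≡ false → ¬ P v
  lookup-select-false eq p = contradiction (trans (sym eq) (lookup-select⁺ p)) λ ()

  ∈-select⁺ : ∀ {v} → P v → v ∈ select
  ∈-select⁺ {v} = lookup⇒[]= v select ∘ lookup-select⁺

  ∈-select⁻ : ∀ {v} → v ∈ select → P v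
  ∈-select⁻ = lookup-select⁻ ∘ []=⇒lookup

Reaches : Distribution n → Capacity n → ℕ → Fin n → Set
Reaches δ c zero    v = δ v ≡ 0
Reaches δ c (suc j) v = Reaches δ c j v ⊎ ∃[ y ] (1 ≤ c v y × Reaches δ c j y)

reaches? : (δ : Distribution n) (c : Capacity n) (j : ℕ) → Decidable (Reaches δ c j)
reaches? δ c zero    v = δ v ℕ.≟ 0
reaches? δ c (suc j) v = reaches? δ c j v ⊎-dec any? λ y → (1 ℕ.≤? c v y) ×-dec reaches? δ c j y

hole-reaches : {δ : Distribution n} {c : Capacity n} (j : ℕ) → ∀ {v} → δ v ≡ 0 → Reaches δ c j v
hole-reaches zero    δv≡0 = δv≡0
hole-reaches (suc j) δv≡0 = inj₁ (hole-reaches j δv≡0)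

Reaches-transport : {δ δ′ : Distribution n} {c c′ : Capacity n} {s : Fin n} →
  (∀ {v} → δ v ≡ 0 → δ′ v ≡ 0) → (∀ {u} v → u ≢ s → 1 ≤ c u v → 1 ≤ c′ u v) →
  ∀ j → ¬ Reaches δ c j s → ∀ {v} → Reaches δ c j v → Reaches δ′ c′ j v
Reaches-transport holes arcs zero    _      r                  = holes r
Reaches-transport holes arcs (suc j) s-unreached (inj₁ r)      =
  inj₁ (Reaches-transport holes arcs j (s-unreached ∘ inj₁) r)
Reaches-transport {s = s} holes arcs (suc j) s-unreached {v} (inj₂ (y , 1≤cvy , r)) =
  inj₂ (y , arcs y v≢s 1≤cvy , Reaches-transport holes arcs j (s-unreached ∘ inj₁) r)
  where
  v≢s : v ≢ s
  v≢s refl = s-unreached (inj₂ (y , 1≤cvy , r))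

Saturated : Distribution n → Capacity n → ℕ → Set
Saturated δ c i = ∀ {v} → Reaches δ c (suc i) v → Reaches δ c i v

module _ (δ : Distribution n) (c : Capacity n) where

  reached : ℕ → Subset n
  reached j = select (reaches? δ c j)

  reached-grows : ∀ i → (∃[ j ] Saturated δ c j) ⊎ (i ≤ ∣ reached i ∣)
  reached-grows zero = inj₂ z≤n
  reached-grows (suc i) with reached-grows i
  ... | inj₁ saturated = inj₁ saturated
  ... | inj₂ i≤ with any? (λ v → reaches? δ c (suc i) v ×-dec ¬? (reaches? δ c i v))
  ...   | no  none = inj₁ (i , λ {v} r → decidable-stable (reaches? δ c i v) λ ¬r → none (v , r , ¬r))
  ...   | yes (v , r , ¬r) = inj₂ (≤-trans (s≤s i≤) (p⊂q⇒∣p∣<∣q∣ reached-i⊂))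
    where
    reached-i⊂ : reached i ⊂ reached (suc i)
    reached-i⊂ = (λ w∈ → ∈-select⁺ (reaches? δ c (suc i)) (inj₁ (∈-select⁻ (reaches? δ c i) w∈)))
               , v , ∈-select⁺ (reaches? δ c (suc i)) r , ¬r ∘ ∈-select⁻ (reaches? δ c i)

  saturates : ∃[ i ] Saturated δ c i
  saturates with reached-grows (suc n)
  ... | inj₁ saturated = saturated
  ... | inj₂ n<        = contradiction (≤-trans n< (∣p∣≤n (reached (suc n)))) 1+n≰n

∣p∣≡sumOver : (p : Subset n) → ∣ p ∣ ≡ sumOver (lookup p) (λ _ → 1)
∣p∣≡sumOver []          = refl
∣p∣≡sumOver (true  ∷ p) = cong suc (∣p∣≡sumOver p)
∣p∣≡sumOver (false ∷ p) = ∣p∣≡sumOver p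

surplus-reaches-hole : {δ : Distribution n} {c : Capacity n} {i : ℕ} → CapSparse δ c → Saturated δ c i →
                       ∀ {s} → 2 ≤ δ s → Reaches δ c i s
surplus-reaches-hole {n} {δ} {c} {i} sparse saturated {s} 2≤δs =
  decidable-stable (reaches? δ c i s) λ s-unreached → 1+n≰n (begin
    1 + ∣ Z ∣                                           ≡⟨ +-comm 1 ∣ Z ∣ ⟩
    ∣ Z ∣ + 1                                           ≡⟨ cong₂ _+_ (∣p∣≡sumOver Z) (sym (s-counted s-unreached)) ⟩
    sumOver (lookup Z) (λ _ → 1) + sumOver (lookup Z) (𝟙 s) ≡⟨ sumOver-+ (lookup Z) (λ _ → 1) (𝟙 s) ⟨
    sumOver (lookup Z) (λ v → 1 + 𝟙 s v)                ≤⟨ sumOver-mono (lookup Z) unreached-weight ⟩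
    δsum δ Z                                            ≤⟨ sparse Z ⟩
    ∣ Z ∣ + outCapacity c Z                             ≡⟨ cong (_+_ ∣ Z ∣) no-exit ⟩
    ∣ Z ∣ + 0                                           ≡⟨ +-identityʳ ∣ Z ∣ ⟩
    ∣ Z ∣                                               ∎)
  where
  open ≤-Reasoning
  Z : Subset n
  Z = select (¬? ∘ reaches? δ c i)

  s-counted : ¬ Reaches δ c i s → sumOver (lookup Z) (𝟙 s) ≡ 1
  s-counted s-unreached =
    trans (sumOver-𝟙 (lookup Z) s) (cong iverson (lookup-select⁺ (¬? ∘ reaches? δ c i) s-unreached))

  unreached-weight : ∀ v → lookup Z v ≡ true → 1 + 𝟙 s v ≤ δ v
  unreached-weight v v∈Z with v ≟ s
  ... | yes refl = 2≤δs
  ... | no  _    = n≢0⇒n>0 λ δv≡0 → lookup-select⁻ (¬? ∘ reaches? δ c i) v∈Z (hole-reaches i δv≡0)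

  reached-of : ∀ {u} → not (lookup Z u) ≡ true → Reaches δ c i u
  reached-of {u} u∉Z with lookup Z u in eq
  ... | false = decidable-stable (reaches? δ c i u) (lookup-select-false (¬? ∘ reaches? δ c i) eq)
  ... | true  = contradiction u∉Z λ ()

  no-exit : outCapacity c Z ≡ 0
  no-exit = sumOver-zero (not ∘ lookup Z) λ u u∉Z → sumOver-zero (lookup Z) λ v v∈Z →
    decidable-stable (c v u ℕ.≟ 0) λ cvu≢0 →
      lookup-select⁻ (¬? ∘ reaches? δ c i) v∈Z (saturated (inj₂ (u , n≢0⇒n>0 cvu≢0 , reached-of u∉Z)))

holes : Distribution n → Subset n
holes δ = select (λ v → δ v ℕ.≟ 0)

zeroFlow : {δ : Distribution n} {c : Capacity n} → (∀ v → δ v < 2) → IsCapFlow δ c (λ _ _ → + 0)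
zeroFlow {n} {δ} small = (λ _ _ → refl) , (λ _ _ → ℤ.+≤+ z≤n) , fits
  where
  fits : ∀ v → Fits (δ v) (sumℤ {n} (λ _ → + 0))
  fits v with δ v | small v
  ... | 0           | _               = inj₂ (refl , sumℤ-zero {n})
  ... | 1           | _               = inj₁ (sumℤ-zero {n})
  ... | suc (suc _) | s≤s (s≤s ())

module Push {n} {δ : Distribution n} {c : Capacity n} {j : ℕ} {s x : Fin n}
            (2≤δs : 2 ≤ δ s) (1≤csx : 1 ≤ c s x) (s-far : ¬ Reaches δ c j s) (x-near : Reaches δ c j x) where

  open Transfer {δ′ = pushDist δ s x} {c′ = pushCap c s x}
    (pushDist-balance {δ = δ} x (≤-trans (s≤s z≤n) 2≤δs)) (pushCap-balance 1≤csx) (pushDist-source {δ = δ} x 2≤δs)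
    public

  s≢x : s ≢ x
  s≢x refl = s-far x-near

  holes-shrink : holes (pushDist δ s x) ⊆ holes δ
  holes-shrink = ∈-select⁺ (λ v → δ v ℕ.≟ 0) ∘ hole-back ∘ ∈-select⁻ (λ v → pushDist δ s x v ℕ.≟ 0)

  hole-filled : δ x ≡ 0 → ∣ holes (pushDist δ s x) ∣ < ∣ holes δ ∣
  hole-filled δx≡0 = p⊂q⇒∣p∣<∣q∣ (holes-shrink , x , ∈-select⁺ (λ v → δ v ℕ.≟ 0) δx≡0 , x-not-hole)
    where
    x-not-hole : x ∉ holes (pushDist δ s x)
    x-not-hole x∈ = contradiction (trans (sym (target-gains s≢x)) (∈-select⁻ (λ v → pushDist δ s x v ℕ.≟ 0) x∈))
                                  (subst (λ t → t + 1 ≢ 0) (sym δx≡0) λ ())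

  target-surplus : 1 ≤ δ x → 2 ≤ pushDist δ s x x
  target-surplus 1≤δx = subst (2 ≤_) (sym (target-gains s≢x)) (+-monoˡ-≤ 1 1≤δx)

  target-near : 1 ≤ δ x → Reaches (pushDist δ s x) (pushCap c s x) j x
  target-near 1≤δx = Reaches-transport (hole-forth 1≤δx) (λ v u≢s 1≤cuv → ≤-trans 1≤cuv (capacity-grows v u≢s))
                                       j s-far x-near

capFlow : ∀ m {δ : Distribution n} {c : Capacity n} → ∣ holes δ ∣ < m → CapSparse δ c → CapFlow δ c
capFlow zero    ()   _
capFlow (suc m) {δ} {c} fuel sparse with any? (λ v → 2 ℕ.≤? δ v) | saturates δ c
... | no  no-surplus  | _             = (λ _ _ → + 0) , zeroFlow (λ v → ≰⇒> (no-surplus ∘ (v ,_)))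
... | yes (s , 2≤δs)  | i , saturated = descend i fuel sparse 2≤δs (surplus-reaches-hole sparse saturated 2≤δs)
  where
  -- Local to the clause so that m stays fixed along the recursion on j, as termination checking needs.
  descend : ∀ j {δ : Distribution _} {c : Capacity _} → ∣ holes δ ∣ < suc m → CapSparse δ c →
            ∀ {s} → 2 ≤ δ s → Reaches δ c j s → CapFlow δ c
  descend zero    fuel sparse 2≤δs δs≡0 = contradiction (subst (2 ≤_) δs≡0 2≤δs) λ ()
  descend (suc j) {δ} {c} fuel sparse {s} 2≤δs reach with reaches? δ c j s
  ... | yes reach′ = descend j fuel sparse 2≤δs reach′
  ... | no  s-far  with reach
  ...   | inj₁ reach′ = contradiction reach′ s-far
  ...   | inj₂ (x , 1≤csx , x-near) with δ x ℕ.≟ 0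
  ...     | yes δx≡0 = lift (capFlow m (≤-trans (hole-filled δx≡0) (ℕ.s≤s⁻¹ fuel)) (sparse-preserved sparse))
    where open Push 2≤δs 1≤csx s-far x-near
  ...     | no  δx≢0 = lift (descend j (≤-<-trans (p⊆q⇒∣p∣≤∣q∣ holes-shrink) fuel) (sparse-preserved sparse)
                                 (target-surplus (n≢0⇒n>0 δx≢0)) (target-near (n≢0⇒n>0 δx≢0)))
    where open Push 2≤δs 1≤csx s-far x-near

-- Graphs

graphCapacity : ℕ → Graph n → Capacity n
graphCapacity k G u v = if adj G u v then k else 0

graphCapacity-≤ : (k : ℕ) (G : Graph n) (u v : Fin n) → graphCapacity k G u v ≤ k
graphCapacity-≤ k G u v with adj G u v
... | true  = ≤-refl
... | false = z≤n

iverson-scaled : ∀ a b k → (if b then (if a then k else 0) else 0) ≡ k * iverson (a ∧ b)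
iverson-scaled true  true  k = sym (*-identityʳ k)
iverson-scaled true  false k = sym (*-zeroʳ k)
iverson-scaled false true  k = sym (*-zeroʳ k)
iverson-scaled false false k = sym (*-zeroʳ k)

outCapacity-graph : (k : ℕ) (G : Graph n) (Z : Subset n) → outCapacity (graphCapacity k G) Z ≡ k * borderSize G Z
outCapacity-graph k G Z =
  trans (sumℕ-cong row) (sumℕ-*ˡ k (λ u → sumℕ (λ v → iverson (adj G u v ∧ not (lookup Z u) ∧ lookup Z v))))
  where
  row : ∀ u → restrict (not ∘ lookup Z) (λ u → sumOver (lookup Z) (λ v → graphCapacity k G v u)) u
            ≡ k * sumℕ (λ v → iverson (adj G u v ∧ not (lookup Z u) ∧ lookup Z v))
  row u with lookup Z u
  ... | true  = sym (trans (cong (_*_ k) no-border) (*-zeroʳ k))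
    where
    no-border : sumℕ (λ v → iverson (adj G u v ∧ false)) ≡ 0
    no-border = sumℕ-zero (λ v → iverson (adj G u v ∧ false)) λ v → cong iverson (∧-zeroʳ (adj G u v))
  ... | false = trans (sumℕ-cong entry) (sumℕ-*ˡ k (λ v → iverson (adj G u v ∧ lookup Z v)))
    where
    entry : ∀ v → (if lookup Z v then graphCapacity k G v u else 0) ≡ k * iverson (adj G u v ∧ lookup Z v)
    entry v rewrite adj-sym G v u = iverson-scaled (adj G u v) (lookup Z v) k

∣i∣≤n : ∀ {i n} → i ≤ℤ + n → - i ≤ℤ + n → ℤ.∣ i ∣ ≤ n
∣i∣≤n {+ _}       (ℤ.+≤+ m≤n) _           = m≤n
∣i∣≤n {ℤ.-[1+ _ ]} _          (ℤ.+≤+ m≤n) = m≤n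

graphFlow : {δ : Distribution n} {k : ℕ} {G : Graph n} {f : Fin n → Fin n → ℤ} →
            IsCapFlow δ (graphCapacity k G) f → IsδFlow G δ f × EdgeBounded k f
graphFlow {k = k} {G} {f} (antisym , bounded , fits) = ((antisym , supported) , fits) , edge-bounded
  where
  bounded-by-k : ∀ u v → f u v ≤ℤ + k
  bounded-by-k u v = ℤ.≤-trans (bounded u v) (ℤ.+≤+ (graphCapacity-≤ k G u v))

  edge-bounded : EdgeBounded k f
  edge-bounded u v = ∣i∣≤n (bounded-by-k u v) (subst (_≤ℤ + k) (antisym v u) (bounded-by-k v u))

  supported : ∀ u v → f u v ≢ + 0 → adj G u v ≡ true
  supported u v f≢0 with adj G u v in uv
  ... | true  = refl
  ... | false = contradiction (ℤ.≤-antisym (no-arc uv) nonneg) f≢0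
    where
    no-arc : ∀ {u v} → adj G u v ≡ false → f u v ≤ℤ + 0
    no-arc {u} {v} uv = subst (λ b → f u v ≤ℤ + (if b then k else 0)) uv (bounded u v)
    nonneg : + 0 ≤ℤ f u v
    nonneg = subst (+ 0 ≤ℤ_) (sym (antisym u v)) (ℤ.neg-mono-≤ (no-arc (trans (adj-sym G v u) uv)))

graph-capSparse : {k : ℕ} {G : Graph n} {δ : Distribution n} → Sparse k G δ → CapSparse δ (graphCapacity k G)
graph-capSparse {k = k} {G} {δ} sparse Z =
  subst (λ b → δsum δ Z ≤ ∣ Z ∣ + b) (sym (outCapacity-graph k G Z)) (sparse Z)

proposition4p10 : (n k : ℕ) (G : Graph n) (δ : Distribution n) → Sparse k G δ →
    Σ (Fin n → Fin n → ℤ) (λ f → IsδFlow G δ f × EdgeBounded k f)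
proposition4p10 n k G δ sparse =
  map₂ (graphFlow {k = k} {G}) (capFlow (suc ∣ holes δ ∣) ≤-refl (graph-capSparse {k = k} {G} sparse))
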